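{- Let $r\ge 1$ and let $\boldsymbol{\alpha}=(\alpha_1,\ldots,\alpha_r)$ be an $r$-tuple of nonnegative integers with $\alpha_r\ge 1$. Then \[ \rho(\alpha_1+1,\alpha_2+1,\ldots,\alpha_r+1)=\frac{1}{|\boldsymbol{\alpha}|!\cdot\prod_{k=1}^r(\alpha_k+\alpha_{k+1}+\cdots+\alpha_r)}, \] where $|\boldsymbol{\alpha}|=\alpha_1+\cdots+\alpha_r$.
   Context: The rising factorial is $(x)_0=1$ and $(x)_n=x(x+1)\cdots(x+n-1)$ for $n\ge 1$. For nonnegative integers $\alpha_1,\ldots,\alpha_r$ with $\alpha_r\ge1$, the multiple $\rho$-value is \[ \rho(\alpha_1+1,\ldots,\alpha_r+1)=\sum_{1\le n_1<n_2<\cdots<n_r}\frac{1}{(n_1)_{\alpha_1+1}(n_2+\alpha_1)_{\alpha_2+1}(n_3+\alpha_1+\alpha_2)_{\alpha_3+1}\cdots(n_r+\alpha_1+\cdots+\alpha_{r-1})_{\alpha_r+1}}. \] -}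

module Defs where

open import Data.Nat as ℕ using (ℕ; zero; suc; _∸_; _!)
open import Data.Integer using (+_)
open import Data.List using (List; []; _∷_; map; upTo; foldr)
open import Data.Rational using (ℚ; 0ℚ; _/_)
import Data.Rational as ℚ

rising : ℕ → ℕ → ℕ
rising x zero    = 1
rising x (suc n) = x ℕ.* rising (suc x) n

-- reciprocal of a natural number as a rational (convention 1/0 := 0;
-- only ever applied to positive numbers in the statement)
recip : ℕ → ℚ
recip zero    = 0ℚ
recip (suc d) = + 1 / suc d

sumℚ : List ℚ → ℚ
sumℚ = foldr ℚ._+_ 0ℚ

sumFromTo : ℕ → ℕ → (ℕ → ℚ) → ℚ
sumFromTo L M f = sumℚ (map (λ i → f (L ℕ.+ i)) (upTo (suc M ∸ L)))

-- nestedSum αs s L M d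
--   = Σ_{L ≤ n_1 < n_2 < ... < n_k ≤ M}
--       1 / (d * (n_1 + s)_{a_1+1} * (n_2 + s + a_1)_{a_2+1} * ...)
-- where αs = a_1 ∷ ... ∷ a_k.
nestedSum : List ℕ → ℕ → ℕ → ℕ → ℕ → ℚ
nestedSum []       s L M d = recip d
nestedSum (a ∷ as) s L M d =
  sumFromTo L M (λ n → nestedSum as (s ℕ.+ a) (suc n) M (d ℕ.* rising (n ℕ.+ s) (suc a)))

-- partial sum of the multiple ρ-value ρ(α_1+1,...,α_r+1):
-- sum over 1 ≤ n_1 < ... < n_r ≤ M
rhoPartial : List ℕ → ℕ → ℚ
rhoPartial αs M = nestedSum αs 0 1 M 1

weight : List ℕ → ℕ
weight = foldr ℕ._+_ 0

prodTails : List ℕ → ℕ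
prodTails []       = 1
prodTails (a ∷ as) = (a ℕ.+ weight as) ℕ.* prodTails as

ConvergesTo : (ℕ → ℚ) → ℚ → Set
ConvergesTo S v = ∀ (ε : ℚ) → 0ℚ ℚ.< ε →
  Σ ℕ (λ N → ∀ M → N ℕ.≤ M → ℚ.∣ S M ℚ.- v ∣ ℚ.< ε)
  where open import Data.Product using (Σ)

-- The telescoping identity 1/(w (x)_w) = 1/(x)_{w+1} + 1/(w (x+1)_w) gives
-- Σ_{y ≥ x} 1/(y)_{w+1} = 1/(w (x)_w). Hence summing out n₁ turns the value
-- 1/(∏_k (α_k + ⋯ + α_r) · (x)_{|α|}) of the series whose shifted first index n₁ + s
-- starts at x into the same expression for (α₂, …, α_r). By induction on r every partial
-- sum lies below this value, and cutting the outer sum after K terms loses at most 1/K.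

module Submission where

open import Defs
open import Data.Nat using (ℕ; zero; suc; _+_; _*_; _∸_; _≤_; _⊔_; _!; s≤s; z≤n; >-nonZero)
import Data.Nat.Properties as ℕ
open import Data.Nat.Coprimality using (1-coprimeTo)
import Data.Nat.Coprimality as Coprime
open import Data.Integer using (+[1+_]; +<+; +≤+)
import Data.Integer as ℤ
import Data.Integer.Properties as ℤ
open import Data.Rational using (ℚ; 0ℚ; 1ℚ; mkℚ; _/_; *≤*; *<*)
import Data.Rational as ℚ
import Data.Rational.Properties as ℚ
open import Data.Rational.Solver using (module +-*-Solver)
open +-*-Solver using (solve; _:+_; _:*_; _:-_; :-_; _:=_)
open import Data.List using (List; []; _∷_; map; applyUpTo)
open import Data.Vec using (Vec; []; _∷_; toList; last)
open import Data.Product using (∃; _×_; _,_)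
open import Data.Unit using (⊤)
open import Function using (_∘_)
open import Relation.Binary.PropositionalEquality

fromℕ : ℕ → ℚ
fromℕ n = ℤ.+ n / 1

fromℕ≡mkℚ : ∀ n → fromℕ n ≡ mkℚ (ℤ.+ n) 0 (Coprime.sym (1-coprimeTo n))
fromℕ≡mkℚ n = ℚ.normalize-coprime (Coprime.sym (1-coprimeTo n))

fromℕ-+ : ∀ m n → fromℕ (m + n) ≡ fromℕ m ℚ.+ fromℕ n
fromℕ-+ m n = trans
  (cong (_/ 1) (sym (cong₂ ℤ._+_ (ℤ.*-identityʳ (ℤ.+ m)) (ℤ.*-identityʳ (ℤ.+ n)))))
  (sym (cong₂ ℚ._+_ (fromℕ≡mkℚ m) (fromℕ≡mkℚ n)))

recip-suc : ∀ d → recip (suc d) ≡ mkℚ (ℤ.+ 1) d (1-coprimeTo (suc d))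
recip-suc d = ℚ.normalize-coprime (1-coprimeTo (suc d))

fromℕ*recip≡1 : ∀ {n} → 1 ≤ n → fromℕ n ℚ.* recip n ≡ 1ℚ
fromℕ*recip≡1 {suc d} _ rewrite fromℕ≡mkℚ (suc d) | recip-suc d =
  ℚ.*-inverseʳ (mkℚ (ℤ.+ suc d) 0 (Coprime.sym (1-coprimeTo (suc d))))

recip-* : ∀ m n → recip (m * n) ≡ recip m ℚ.* recip n
recip-* zero    n       = sym (ℚ.*-zeroˡ (recip n))
recip-* (suc a) zero    rewrite ℕ.*-zeroʳ a = sym (ℚ.*-zeroʳ (recip (suc a)))
recip-* (suc a) (suc b) rewrite recip-suc a | recip-suc b = refl

*-exchange : ∀ p q r → p ℚ.* (q ℚ.* r) ≡ q ℚ.* (p ℚ.* r)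
*-exchange = solve 3 (λ p q r → p :* (q :* r) := q :* (p :* r)) refl

+-interchange : ∀ p q r s → p ℚ.+ q ℚ.+ (r ℚ.+ s) ≡ p ℚ.+ r ℚ.+ (q ℚ.+ s)
+-interchange = solve 4 (λ p q r s → p :+ q :+ (r :+ s) := p :+ r :+ (q :+ s)) refl

recip≡fromℕ*recip[*] : ∀ m {k} → 1 ≤ k → recip m ≡ fromℕ k ℚ.* recip (m * k)
recip≡fromℕ*recip[*] m {k} 1≤k = sym (begin
  fromℕ k ℚ.* recip (m * k)          ≡⟨ cong (fromℕ k ℚ.*_) (recip-* m k) ⟩
  fromℕ k ℚ.* (recip m ℚ.* recip k)  ≡⟨ *-exchange (fromℕ k) (recip m) (recip k) ⟩
  recip m ℚ.* (fromℕ k ℚ.* recip k)  ≡⟨ cong (recip m ℚ.*_) (fromℕ*recip≡1 1≤k) ⟩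
  recip m ℚ.* 1ℚ                     ≡⟨ ℚ.*-identityʳ (recip m) ⟩
  recip m                            ∎)
  where open ≡-Reasoning

recip[n+n]+recip[n+n]≡recip : ∀ {n} → 1 ≤ n → recip (n + n) ℚ.+ recip (n + n) ≡ recip n
recip[n+n]+recip[n+n]≡recip {n} _ = sym (begin
  recip n                                   ≡⟨ recip≡fromℕ*recip[*] n {2} (s≤s z≤n) ⟩
  fromℕ 2 ℚ.* recip (n * 2)                 ≡⟨ cong₂ ℚ._*_ (fromℕ-+ 1 1) (cong recip n*2≡n+n) ⟩
  (1ℚ ℚ.+ 1ℚ) ℚ.* recip (n + n)             ≡⟨ ℚ.*-distribʳ-+ (recip (n + n)) 1ℚ 1ℚ ⟩
  1ℚ ℚ.* recip (n + n) ℚ.+ 1ℚ ℚ.* recip (n + n)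
    ≡⟨ cong₂ ℚ._+_ (ℚ.*-identityˡ (recip (n + n))) (ℚ.*-identityˡ (recip (n + n))) ⟩
  recip (n + n) ℚ.+ recip (n + n)           ∎)
  where
  open ≡-Reasoning
  n*2≡n+n : n * 2 ≡ n + n
  n*2≡n+n = trans (ℕ.*-comm n 2) (cong (n +_) (ℕ.+-identityʳ n))

recip-nonNeg : ∀ n → 0ℚ ℚ.≤ recip n
recip-nonNeg zero    = ℚ.≤-refl
recip-nonNeg (suc d) = ℚ.nonNegative⁻¹ _ {{ℚ.normalize-nonNeg 1 (suc d)}}

recip-antimono-≤ : ∀ {m n} → 1 ≤ m → m ≤ n → recip n ℚ.≤ recip m
recip-antimono-≤ {suc a} {suc b} _ m≤n rewrite recip-suc a | recip-suc b =
  *≤* (subst₂ ℤ._≤_ (sym (ℤ.*-identityˡ (ℤ.+ suc a))) (sym (ℤ.*-identityˡ (ℤ.+ suc b))) (+≤+ m≤n))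

recip≤1 : ∀ n → recip n ℚ.≤ 1ℚ
recip≤1 zero    = recip-nonNeg 1
recip≤1 (suc n) = recip-antimono-≤ {1} {suc n} (s≤s z≤n) (s≤s z≤n)

-- For ε = (p + 1)/(d + 1) the witness 1/(d + 2) works.
recip-archimedean : ∀ ε → 0ℚ ℚ.< ε → ∃ λ j → recip (suc j) ℚ.< ε
recip-archimedean (mkℚ (ℤ.+ 0)      d _) (*<* (+<+ ()))
recip-archimedean (mkℚ +[1+ p ] d c) (*<* _) = suc d ,
  subst (ℚ._< mkℚ +[1+ p ] d c) (sym (recip-suc (suc d)))
    (*<* (+<+ (s≤s (s≤s (ℕ.+-monoʳ-≤ d z≤n)))))

p≤p+q : ∀ {p q} → 0ℚ ℚ.≤ q → p ℚ.≤ p ℚ.+ q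
p≤p+q {p} 0≤q = ℚ.≤-trans (ℚ.≤-reflexive (sym (ℚ.+-identityʳ p))) (ℚ.+-monoʳ-≤ p 0≤q)

*-nonNeg : ∀ {p q} → 0ℚ ℚ.≤ p → 0ℚ ℚ.≤ q → 0ℚ ℚ.≤ p ℚ.* q
*-nonNeg {p} {q} 0≤p 0≤q = ℚ.nonNegative⁻¹ _
  {{ℚ.nonNeg*nonNeg⇒nonNeg p {{ℚ.nonNegative 0≤p}} q {{ℚ.nonNegative 0≤q}}}}

*-monoˡ-≤-of-nonNeg : ∀ {r p q} → 0ℚ ℚ.≤ r → p ℚ.≤ q → r ℚ.* p ℚ.≤ r ℚ.* q
*-monoˡ-≤-of-nonNeg {r} 0≤r = ℚ.*-monoˡ-≤-nonNeg r {{ℚ.nonNegative 0≤r}}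

scaleˡ-≤-+ : ∀ {f v g r} → 0ℚ ℚ.≤ f → f ℚ.≤ 1ℚ → 0ℚ ℚ.≤ r →
  v ℚ.≤ g ℚ.+ r → f ℚ.* v ℚ.≤ f ℚ.* g ℚ.+ r
scaleˡ-≤-+ {f} {v} {g} {r} 0≤f f≤1 0≤r v≤g+r = begin
  f ℚ.* v                  ≤⟨ *-monoˡ-≤-of-nonNeg 0≤f v≤g+r ⟩
  f ℚ.* (g ℚ.+ r)          ≡⟨ ℚ.*-distribˡ-+ f g r ⟩
  f ℚ.* g ℚ.+ f ℚ.* r      ≤⟨ ℚ.+-monoʳ-≤ (f ℚ.* g) (ℚ.*-monoʳ-≤-nonNeg r {{ℚ.nonNegative 0≤r}} f≤1) ⟩
  f ℚ.* g ℚ.+ 1ℚ ℚ.* r     ≡⟨ cong (f ℚ.* g ℚ.+_) (ℚ.*-identityˡ r) ⟩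
  f ℚ.* g ℚ.+ r            ∎
  where open ℚ.≤-Reasoning

∣p-q∣< : ∀ {p q r ε} → p ℚ.≤ q → q ℚ.≤ p ℚ.+ r → r ℚ.< ε → ℚ.∣ p ℚ.- q ∣ ℚ.< ε
∣p-q∣< {p} {q} {r} {ε} p≤q q≤p+r r<ε = begin-strict
  ℚ.∣ p ℚ.- q ∣            ≡⟨ cong ℚ.∣_∣ (p-q≡-[q-p] p q) ⟩
  ℚ.∣ ℚ.- (q ℚ.- p) ∣      ≡⟨ ℚ.∣-p∣≡∣p∣ (q ℚ.- p) ⟩
  ℚ.∣ q ℚ.- p ∣            ≡⟨ ℚ.0≤p⇒∣p∣≡p 0≤q-p ⟩
  q ℚ.- p                  ≤⟨ ℚ.+-monoˡ-≤ (ℚ.- p) q≤p+r ⟩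
  p ℚ.+ r ℚ.- p            ≡⟨ p+r-p≡r p r ⟩
  r                        <⟨ r<ε ⟩
  ε                        ∎
  where
  open ℚ.≤-Reasoning
  p-q≡-[q-p] : ∀ p q → p ℚ.- q ≡ ℚ.- (q ℚ.- p)
  p-q≡-[q-p] = solve 2 (λ p q → p :- q := :- (q :- p)) refl
  p+r-p≡r : ∀ p r → p ℚ.+ r ℚ.- p ≡ r
  p+r-p≡r = solve 2 (λ p r → p :+ r :- p := r) refl
  0≤q-p : 0ℚ ℚ.≤ q ℚ.- p
  0≤q-p = ℚ.≤-trans (ℚ.≤-reflexive (sym (ℚ.+-inverseʳ p))) (ℚ.+-monoˡ-≤ (ℚ.- p) p≤q)

sumFrom : ℕ → ℕ → (ℕ → ℚ) → ℚ
sumFrom L zero    g = 0ℚ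
sumFrom L (suc k) g = g L ℚ.+ sumFrom (suc L) k g

sumℚ-map-applyUpTo : ∀ k (h : ℕ → ℕ) (g f : ℕ → ℚ) L → (∀ i → g (h i) ≡ f (L + i)) →
  sumℚ (map g (applyUpTo h k)) ≡ sumFrom L k f
sumℚ-map-applyUpTo zero    h g f L g∘h≗f = refl
sumℚ-map-applyUpTo (suc k) h g f L g∘h≗f = cong₂ ℚ._+_
  (trans (g∘h≗f 0) (cong f (ℕ.+-identityʳ L)))
  (sumℚ-map-applyUpTo k (h ∘ suc) g f (suc L)
    (λ i → trans (g∘h≗f (suc i)) (cong f (ℕ.+-suc L i))))

sumFromTo≡sumFrom : ∀ L M f → sumFromTo L M f ≡ sumFrom L (suc M ∸ L) f
sumFromTo≡sumFrom L M f =
  sumℚ-map-applyUpTo (suc M ∸ L) (λ i → i) (λ i → f (L + i)) f L (λ _ → refl)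

sumFrom-cong : ∀ L k {g h : ℕ → ℚ} → (∀ n → g n ≡ h n) → sumFrom L k g ≡ sumFrom L k h
sumFrom-cong L zero    g≗h = refl
sumFrom-cong L (suc k) g≗h = cong₂ ℚ._+_ (g≗h L) (sumFrom-cong (suc L) k g≗h)

*-distribˡ-sumFrom : ∀ c L k g → c ℚ.* sumFrom L k g ≡ sumFrom L k (λ n → c ℚ.* g n)
*-distribˡ-sumFrom c L zero    g = ℚ.*-zeroʳ c
*-distribˡ-sumFrom c L (suc k) g = trans (ℚ.*-distribˡ-+ c (g L) _)
  (cong (c ℚ.* g L ℚ.+_) (*-distribˡ-sumFrom c (suc L) k g))

sumFrom-shift : ∀ L k s (g : ℕ → ℚ) → sumFrom L k (λ n → g (n + s)) ≡ sumFrom (L + s) k g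
sumFrom-shift L zero    s g = refl
sumFrom-shift L (suc k) s g = cong (g (L + s) ℚ.+_) (sumFrom-shift (suc L) k s g)

sumFrom-const : ∀ L k c → sumFrom L k (λ _ → c) ≡ fromℕ k ℚ.* c
sumFrom-const L zero    c = sym (ℚ.*-zeroˡ c)
sumFrom-const L (suc k) c = begin
  c ℚ.+ sumFrom (suc L) k (λ _ → c)  ≡⟨ cong (c ℚ.+_) (sumFrom-const (suc L) k c) ⟩
  c ℚ.+ fromℕ k ℚ.* c                 ≡⟨ cong (ℚ._+ fromℕ k ℚ.* c) (sym (ℚ.*-identityˡ c)) ⟩
  1ℚ ℚ.* c ℚ.+ fromℕ k ℚ.* c          ≡⟨ ℚ.*-distribʳ-+ c 1ℚ (fromℕ k) ⟨
  (1ℚ ℚ.+ fromℕ k) ℚ.* c              ≡⟨ cong (ℚ._* c) (fromℕ-+ 1 k) ⟨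
  fromℕ (suc k) ℚ.* c                 ∎
  where open ≡-Reasoning

sumFrom-mono-≤ : ∀ L k {g h : ℕ → ℚ} → (∀ n → g n ℚ.≤ h n) → sumFrom L k g ℚ.≤ sumFrom L k h
sumFrom-mono-≤ L zero    g≤h = ℚ.≤-refl
sumFrom-mono-≤ L (suc k) g≤h = ℚ.+-mono-≤ (g≤h L) (sumFrom-mono-≤ (suc L) k g≤h)

sumFrom-nonNeg : ∀ L k {g : ℕ → ℚ} → (∀ n → 0ℚ ℚ.≤ g n) → 0ℚ ℚ.≤ sumFrom L k g
sumFrom-nonNeg L zero    0≤g = ℚ.≤-refl
sumFrom-nonNeg L (suc k) 0≤g = ℚ.+-mono-≤ (0≤g L) (sumFrom-nonNeg (suc L) k 0≤g)

sumFrom-monoˡ-≤ : ∀ L {k k'} {g : ℕ → ℚ} → (∀ n → 0ℚ ℚ.≤ g n) → k ≤ k' →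
  sumFrom L k g ℚ.≤ sumFrom L k' g
sumFrom-monoˡ-≤ L {k' = k'} 0≤g z≤n = sumFrom-nonNeg L k' 0≤g
sumFrom-monoˡ-≤ L {g = g}   0≤g (s≤s k≤k') = ℚ.+-monoʳ-≤ (g L) (sumFrom-monoˡ-≤ (suc L) 0≤g k≤k')

Eventually : (ℕ → Set) → Set
Eventually P = ∃ λ N → ∀ M → N ≤ M → P M

eventually-≥ : ∀ N → Eventually (N ≤_)
eventually-≥ N = N , λ _ N≤M → N≤M

eventually-× : ∀ {P Q : ℕ → Set} → Eventually P → Eventually Q → Eventually (λ M → P M × Q M)
eventually-× (N₁ , p) (N₂ , q) = N₁ ⊔ N₂ , λ M N≤M →
  p M (ℕ.≤-trans (ℕ.m≤m⊔n N₁ N₂) N≤M) , q M (ℕ.≤-trans (ℕ.m≤n⊔m N₁ N₂) N≤M)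

eventually-map : ∀ {P Q : ℕ → Set} → (∀ M → P M → Q M) → Eventually P → Eventually Q
eventually-map P⇒Q (N , p) = N , λ M N≤M → P⇒Q M (p M N≤M)

sumFrom-eventually-≤ : ∀ {a : ℕ → ℚ} {b : ℕ → ℕ → ℚ} {r} L k →
  (∀ n → Eventually (λ M → a n ℚ.≤ b n M ℚ.+ r)) →
  Eventually (λ M → sumFrom L k a ℚ.≤ sumFrom L k (λ n → b n M) ℚ.+ sumFrom L k (λ _ → r))
sumFrom-eventually-≤ L zero    _ = 0 , λ _ _ → ℚ.≤-reflexive (sym (ℚ.+-identityʳ 0ℚ))
sumFrom-eventually-≤ {b = b} {r} L (suc k) a≤b+r = eventually-map
  (λ M (head≤ , rest≤) → ℚ.≤-trans (ℚ.+-mono-≤ head≤ rest≤) (ℚ.≤-reflexive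
    (+-interchange (b L M) r (sumFrom (suc L) k (λ n → b n M)) (sumFrom (suc L) k (λ _ → r)))))
  (eventually-× (a≤b+r L) (sumFrom-eventually-≤ (suc L) k a≤b+r))

rising-+ : ∀ x m k → rising x (m + k) ≡ rising x m * rising (x + m) k
rising-+ x zero    k = sym (trans (ℕ.*-identityˡ _) (cong (λ y → rising y k) (ℕ.+-identityʳ x)))
rising-+ x (suc m) k = begin
  x * rising (suc x) (m + k)                      ≡⟨ cong (x *_) (rising-+ (suc x) m k) ⟩
  x * (rising (suc x) m * rising (suc x + m) k)   ≡⟨ ℕ.*-assoc x (rising (suc x) m) _ ⟨
  x * rising (suc x) m * rising (suc x + m) k     ≡⟨ cong (λ y → x * rising (suc x) m * rising y k) (ℕ.+-suc x m) ⟨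
  x * rising (suc x) m * rising (x + suc m) k     ∎
  where open ≡-Reasoning

rising-sucʳ : ∀ x w → rising x (suc w) ≡ rising x w * (x + w)
rising-sucʳ x w = begin
  rising x (suc w)             ≡⟨ cong (rising x) (ℕ.+-comm 1 w) ⟩
  rising x (w + 1)             ≡⟨ rising-+ x w 1 ⟩
  rising x w * ((x + w) * 1)   ≡⟨ cong (rising x w *_) (ℕ.*-identityʳ (x + w)) ⟩
  rising x w * (x + w)         ∎
  where open ≡-Reasoning

1≤rising : ∀ {x} w → 1 ≤ x → 1 ≤ rising x w
1≤rising zero    _   = s≤s z≤n
1≤rising (suc w) 1≤x = ℕ.*-mono-≤ 1≤x (1≤rising w (s≤s z≤n))

x≤rising : ∀ x {w} → 1 ≤ w → x ≤ rising x w
x≤rising x {suc w} _ = subst (_≤ rising x (suc w)) (ℕ.*-identityʳ x)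
  (ℕ.*-monoʳ-≤ x (1≤rising w (s≤s z≤n)))

rising-! : ∀ x w → rising (suc x) w * x ! ≡ (x + w) !
rising-! x zero    = trans (ℕ.+-identityʳ _) (cong _! (sym (ℕ.+-identityʳ x)))
rising-! x (suc w) = begin
  suc x * rising (suc (suc x)) w * x !     ≡⟨ cong (_* x !) (ℕ.*-comm (suc x) (rising (suc (suc x)) w)) ⟩
  rising (suc (suc x)) w * suc x * x !     ≡⟨ ℕ.*-assoc (rising (suc (suc x)) w) (suc x) (x !) ⟩
  rising (suc (suc x)) w * (suc x) !       ≡⟨ rising-! (suc x) w ⟩
  (suc x + w) !                            ≡⟨ cong _! (ℕ.+-suc x w) ⟨
  (x + suc w) !                            ∎
  where open ≡-Reasoning

-- 1/(w (x)_w) = (x + w)/(w (x)_{w+1}); split x + w and use (x)_{w+1} = x (x+1)_w.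
recip-rising-step : ∀ {w x} → 1 ≤ w → 1 ≤ x →
  recip (w * rising x w) ≡ recip (rising x (suc w)) ℚ.+ recip (w * rising (suc x) w)
recip-rising-step {w} {x} 1≤w 1≤x = begin
  recip (w * rising x w)
    ≡⟨ recip≡fromℕ*recip[*] (w * rising x w) (ℕ.≤-trans 1≤x (ℕ.m≤m+n x w)) ⟩
  fromℕ (x + w) ℚ.* recip (w * rising x w * (x + w))
    ≡⟨ cong₂ ℚ._*_ (fromℕ-+ x w) (trans (cong recip w*P′≡w*P) (recip-* w P)) ⟩
  (fromℕ x ℚ.+ fromℕ w) ℚ.* (recip w ℚ.* recip P)
    ≡⟨ distribute (fromℕ x) (fromℕ w) (recip w) (recip P) ⟩
  fromℕ w ℚ.* recip w ℚ.* recip P ℚ.+ recip w ℚ.* (fromℕ x ℚ.* recip P)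
    ≡⟨ cong₂ ℚ._+_ (trans (cong (ℚ._* recip P) (fromℕ*recip≡1 1≤w)) (ℚ.*-identityˡ (recip P)))
                   (cong (recip w ℚ.*_) (sym recip-rising-suc)) ⟩
  recip P ℚ.+ recip w ℚ.* recip (rising (suc x) w)
    ≡⟨ cong (recip P ℚ.+_) (recip-* w (rising (suc x) w)) ⟨
  recip P ℚ.+ recip (w * rising (suc x) w)
    ∎
  where
  open ≡-Reasoning
  P : ℕ
  P = rising x (suc w)
  w*P′≡w*P : w * rising x w * (x + w) ≡ w * P
  w*P′≡w*P = trans (ℕ.*-assoc w _ _) (cong (w *_) (sym (rising-sucʳ x w)))
  recip-rising-suc : recip (rising (suc x) w) ≡ fromℕ x ℚ.* recip P
  recip-rising-suc = trans (recip≡fromℕ*recip[*] (rising (suc x) w) 1≤x)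
    (cong (λ y → fromℕ x ℚ.* recip y) (ℕ.*-comm (rising (suc x) w) x))
  distribute : ∀ a b c p → (a ℚ.+ b) ℚ.* (c ℚ.* p) ≡ b ℚ.* c ℚ.* p ℚ.+ c ℚ.* (a ℚ.* p)
  distribute = solve 4 (λ a b c p → (a :+ b) :* (c :* p) := b :* c :* p :+ c :* (a :* p)) refl

recip-rising-telescope : ∀ {w} k x → 1 ≤ w → 1 ≤ x →
  recip (w * rising x w)
    ≡ sumFrom x k (λ y → recip (rising y (suc w))) ℚ.+ recip (w * rising (x + k) w)
recip-rising-telescope {w} zero    x _   _   =
  sym (trans (ℚ.+-identityˡ _) (cong (λ y → recip (w * rising y w)) (ℕ.+-identityʳ x)))
recip-rising-telescope {w} (suc k) x 1≤w 1≤x = begin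
  recip (w * rising x w)
    ≡⟨ recip-rising-step 1≤w 1≤x ⟩
  t x ℚ.+ recip (w * rising (suc x) w)
    ≡⟨ cong (t x ℚ.+_) (recip-rising-telescope k (suc x) 1≤w (s≤s z≤n)) ⟩
  t x ℚ.+ (sumFrom (suc x) k t ℚ.+ recip (w * rising (suc x + k) w))
    ≡⟨ ℚ.+-assoc (t x) (sumFrom (suc x) k t) _ ⟨
  sumFrom x (suc k) t ℚ.+ recip (w * rising (suc x + k) w)
    ≡⟨ cong (λ y → sumFrom x (suc k) t ℚ.+ recip (w * rising y w)) (ℕ.+-suc x k) ⟨
  sumFrom x (suc k) t ℚ.+ recip (w * rising (x + suc k) w)
    ∎
  where
  open ≡-Reasoning
  t : ℕ → ℚ
  t y = recip (rising y (suc w))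

TailsPositive : List ℕ → Set
TailsPositive []       = ⊤
TailsPositive (a ∷ as) = 1 ≤ a + weight as × TailsPositive as

1≤prodTails : ∀ {as} → TailsPositive as → 1 ≤ prodTails as
1≤prodTails {[]}     _         = s≤s z≤n
1≤prodTails {a ∷ as} (1≤w , tp) = ℕ.*-mono-≤ 1≤w (1≤prodTails tp)

partialSum : List ℕ → ℕ → ℕ → ℕ → ℚ
partialSum []       s L M = 1ℚ
partialSum (a ∷ as) s L M = sumFrom L (suc M ∸ L) λ n →
  recip (rising (n + s) (suc a)) ℚ.* partialSum as (s + a) (suc n) M

nestedSum≡recip*partialSum : ∀ as s L M d → nestedSum as s L M d ≡ recip d ℚ.* partialSum as s L M
nestedSum≡recip*partialSum []       s L M d = sym (ℚ.*-identityʳ (recip d))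
nestedSum≡recip*partialSum (a ∷ as) s L M d = begin
  sumFromTo L M (λ n → nestedSum as (s + a) (suc n) M (d * f n))
    ≡⟨ sumFromTo≡sumFrom L M _ ⟩
  sumFrom L (suc M ∸ L) (λ n → nestedSum as (s + a) (suc n) M (d * f n))
    ≡⟨ sumFrom-cong L (suc M ∸ L) factor ⟩
  sumFrom L (suc M ∸ L) (λ n → recip d ℚ.* (recip (f n) ℚ.* partialSum as (s + a) (suc n) M))
    ≡⟨ *-distribˡ-sumFrom (recip d) L (suc M ∸ L) _ ⟨
  recip d ℚ.* partialSum (a ∷ as) s L M
    ∎
  where
  open ≡-Reasoning
  f : ℕ → ℕ
  f n = rising (n + s) (suc a)
  factor : ∀ n → nestedSum as (s + a) (suc n) M (d * f n)
               ≡ recip d ℚ.* (recip (f n) ℚ.* partialSum as (s + a) (suc n) M)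
  factor n = trans (nestedSum≡recip*partialSum as (s + a) (suc n) M (d * f n))
    (trans (cong (ℚ._* partialSum as (s + a) (suc n) M) (recip-* d (f n)))
           (ℚ.*-assoc (recip d) (recip (f n)) _))

partialSum-nonNeg : ∀ as s L M → 0ℚ ℚ.≤ partialSum as s L M
partialSum-nonNeg []       s L M = recip-nonNeg 1
partialSum-nonNeg (a ∷ as) s L M = sumFrom-nonNeg L (suc M ∸ L) λ n →
  *-nonNeg (recip-nonNeg (rising (n + s) (suc a))) (partialSum-nonNeg as (s + a) (suc n) M)

-- The limit of partialSum as s L M as M → ∞; it depends only on x = L + s.
nestedLimit : List ℕ → ℕ → ℚ
nestedLimit as x = recip (prodTails as) ℚ.* recip (rising x (weight as))

nestedLimit-nonNeg : ∀ as x → 0ℚ ℚ.≤ nestedLimit as x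
nestedLimit-nonNeg as x = *-nonNeg (recip-nonNeg (prodTails as)) (recip-nonNeg (rising x (weight as)))

nestedLimit≤recip : ∀ {as} → TailsPositive as → 1 ≤ weight as → ∀ {k x} → 1 ≤ k → k ≤ x →
  nestedLimit as x ℚ.≤ recip k
nestedLimit≤recip {as} tp 1≤w {k} {x} 1≤k k≤x = begin
  nestedLimit as x                              ≡⟨ recip-* (prodTails as) _ ⟨
  recip (prodTails as * rising x (weight as))   ≤⟨ recip-antimono-≤ 1≤k k≤cR ⟩
  recip k                                       ∎
  where
  open ℚ.≤-Reasoning
  k≤cR : k ≤ prodTails as * rising x (weight as)
  k≤cR = ℕ.≤-trans k≤x (ℕ.≤-trans (x≤rising x 1≤w) (ℕ.m≤n*m _ (prodTails as) {{>-nonZero (1≤prodTails tp)}}))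

nestedLimit-cons : ∀ a as x → let w = a + weight as in
  nestedLimit (a ∷ as) x ≡ recip (prodTails as) ℚ.* recip (w * rising x w)
nestedLimit-cons a as x = begin
  recip (w * c) ℚ.* recip R            ≡⟨ cong (ℚ._* recip R) (recip-* w c) ⟩
  recip w ℚ.* recip c ℚ.* recip R      ≡⟨ cong (ℚ._* recip R) (ℚ.*-comm (recip w) (recip c)) ⟩
  recip c ℚ.* recip w ℚ.* recip R      ≡⟨ ℚ.*-assoc (recip c) (recip w) (recip R) ⟩
  recip c ℚ.* (recip w ℚ.* recip R)    ≡⟨ cong (recip c ℚ.*_) (recip-* w R) ⟨
  recip c ℚ.* recip (w * R)            ∎
  where
  open ≡-Reasoning
  w : ℕ
  w = a + weight as
  c : ℕ
  c = prodTails as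
  R : ℕ
  R = rising x w

recip-rising*nestedLimit : ∀ a as y →
  recip (rising y (suc a)) ℚ.* nestedLimit as (y + suc a)
    ≡ recip (prodTails as) ℚ.* recip (rising y (suc (a + weight as)))
recip-rising*nestedLimit a as y = begin
  recip r ℚ.* (recip c ℚ.* recip r′)   ≡⟨ *-exchange (recip r) (recip c) (recip r′) ⟩
  recip c ℚ.* (recip r ℚ.* recip r′)   ≡⟨ cong (recip c ℚ.*_) (recip-* r r′) ⟨
  recip c ℚ.* recip (r * r′)           ≡⟨ cong (λ z → recip c ℚ.* recip z) (rising-+ y (suc a) (weight as)) ⟨
  recip c ℚ.* recip (rising y (suc a + weight as)) ∎
  where
  open ≡-Reasoning
  c : ℕ
  c = prodTails as
  r : ℕ
  r = rising y (suc a)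
  r′ : ℕ
  r′ = rising (y + suc a) (weight as)

nestedLimit-unfold : ∀ a as s L k → 1 ≤ a + weight as → 1 ≤ L + s →
  nestedLimit (a ∷ as) (L + s)
    ≡ sumFrom L k (λ n → recip (rising (n + s) (suc a)) ℚ.* nestedLimit as (suc n + (s + a)))
      ℚ.+ nestedLimit (a ∷ as) (L + s + k)
nestedLimit-unfold a as s L k 1≤w 1≤x = begin
  nestedLimit (a ∷ as) x
    ≡⟨ nestedLimit-cons a as x ⟩
  C ℚ.* recip (w * rising x w)
    ≡⟨ cong (C ℚ.*_) (recip-rising-telescope k x 1≤w 1≤x) ⟩
  C ℚ.* (sumFrom x k t ℚ.+ recip (w * rising (x + k) w))
    ≡⟨ ℚ.*-distribˡ-+ C (sumFrom x k t) _ ⟩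
  C ℚ.* sumFrom x k t ℚ.+ C ℚ.* recip (w * rising (x + k) w)
    ≡⟨ cong₂ ℚ._+_ summands (sym (nestedLimit-cons a as (x + k))) ⟩
  sumFrom L k term ℚ.+ nestedLimit (a ∷ as) (x + k)
    ∎
  where
  open ≡-Reasoning
  x : ℕ
  x = L + s
  w : ℕ
  w = a + weight as
  C : ℚ
  C = recip (prodTails as)
  t : ℕ → ℚ
  t y = recip (rising y (suc w))
  term : ℕ → ℚ
  term n = recip (rising (n + s) (suc a)) ℚ.* nestedLimit as (suc n + (s + a))
  term≡ : ∀ n → term n ≡ C ℚ.* t (n + s)
  term≡ n = trans
    (cong (λ y → recip (rising (n + s) (suc a)) ℚ.* nestedLimit as y)
          (sym (trans (ℕ.+-suc (n + s) a) (cong suc (ℕ.+-assoc n s a)))))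
    (recip-rising*nestedLimit a as (n + s))
  summands : C ℚ.* sumFrom x k t ≡ sumFrom L k term
  summands = begin
    C ℚ.* sumFrom x k t                       ≡⟨ *-distribˡ-sumFrom C x k t ⟩
    sumFrom (L + s) k (λ y → C ℚ.* t y)       ≡⟨ sumFrom-shift L k s _ ⟨
    sumFrom L k (λ n → C ℚ.* t (n + s))       ≡⟨ sumFrom-cong L k (sym ∘ term≡) ⟩
    sumFrom L k term                          ∎

partialSum≤nestedLimit : ∀ as → TailsPositive as → ∀ s L M → 1 ≤ L →
  partialSum as s L M ℚ.≤ nestedLimit as (L + s)
partialSum≤nestedLimit []       _          s L M _   = ℚ.≤-refl
partialSum≤nestedLimit (a ∷ as) (1≤w , tp) s L M 1≤L = begin
  partialSum (a ∷ as) s L M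
    ≤⟨ sumFrom-mono-≤ L k (λ n → *-monoˡ-≤-of-nonNeg (recip-nonNeg (rising (n + s) (suc a)))
         (partialSum≤nestedLimit as tp (s + a) (suc n) M (s≤s z≤n))) ⟩
  sumFrom L k term
    ≤⟨ p≤p+q (nestedLimit-nonNeg (a ∷ as) (L + s + k)) ⟩
  sumFrom L k term ℚ.+ nestedLimit (a ∷ as) (L + s + k)
    ≡⟨ nestedLimit-unfold a as s L k 1≤w (ℕ.≤-trans 1≤L (ℕ.m≤m+n L s)) ⟨
  nestedLimit (a ∷ as) (L + s)
    ∎
  where
  open ℚ.≤-Reasoning
  k : ℕ
  k = suc M ∸ L
  term : ℕ → ℚ
  term n = recip (rising (n + s) (suc a)) ℚ.* nestedLimit as (suc n + (s + a))

partialSum-prefix : ∀ a as s L {K M} → K + L ≤ M →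
  sumFrom L K (λ n → recip (rising (n + s) (suc a)) ℚ.* partialSum as (s + a) (suc n) M)
    ℚ.≤ partialSum (a ∷ as) s L M
partialSum-prefix a as s L {K} {M} K+L≤M = sumFrom-monoˡ-≤ L
  (λ n → *-nonNeg (recip-nonNeg (rising (n + s) (suc a))) (partialSum-nonNeg as (s + a) (suc n) M))
  (ℕ.m+n≤o⇒m≤o∸n K (ℕ.≤-trans K+L≤M (ℕ.n≤1+n M)))

-- Take K = 2e outer terms: the missing tail is at most 1/K, and each of the K
-- inner sums is made accurate to 1/K², contributing at most K · 1/K² = 1/K.
nestedLimit≤partialSum+recip : ∀ as → TailsPositive as → ∀ s L → 1 ≤ L → ∀ {e} → 1 ≤ e →
  Eventually (λ M → nestedLimit as (L + s) ℚ.≤ partialSum as s L M ℚ.+ recip e)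
nestedLimit≤partialSum+recip []       _          s L _   {e} _ = 0 , λ _ _ → p≤p+q (recip-nonNeg e)
nestedLimit≤partialSum+recip (a ∷ as) (1≤w , tp) s L 1≤L {e} 1≤e =
  eventually-map bound (eventually-× (sumFrom-eventually-≤ L K termwise) (eventually-≥ (K + L)))
  where
  open ℚ.≤-Reasoning
  K : ℕ
  K = e + e
  1≤K : 1 ≤ K
  1≤K = ℕ.≤-trans 1≤e (ℕ.m≤m+n e e)
  f : ℕ → ℚ
  f n = recip (rising (n + s) (suc a))
  limit : ℕ → ℚ
  limit n = f n ℚ.* nestedLimit as (suc n + (s + a))
  partial : ℕ → ℕ → ℚ
  partial n M = f n ℚ.* partialSum as (s + a) (suc n) M
  termwise : ∀ n → Eventually (λ M → limit n ℚ.≤ partial n M ℚ.+ recip (K * K))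
  termwise n = eventually-map
    (λ _ → scaleˡ-≤-+ (recip-nonNeg (rising (n + s) (suc a))) (recip≤1 (rising (n + s) (suc a)))
                      (recip-nonNeg (K * K)))
    (nestedLimit≤partialSum+recip as tp (s + a) (suc n) (s≤s z≤n) (ℕ.*-mono-≤ 1≤K 1≤K))
  bound : ∀ M →
    (sumFrom L K limit ℚ.≤ sumFrom L K (λ n → partial n M) ℚ.+ sumFrom L K (λ _ → recip (K * K)))
    × (K + L ≤ M) →
    nestedLimit (a ∷ as) (L + s) ℚ.≤ partialSum (a ∷ as) s L M ℚ.+ recip e
  bound M (sum≤ , K+L≤M) = begin
    nestedLimit (a ∷ as) (L + s)
      ≡⟨ nestedLimit-unfold a as s L K 1≤w (ℕ.≤-trans 1≤L (ℕ.m≤m+n L s)) ⟩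
    sumFrom L K limit ℚ.+ nestedLimit (a ∷ as) (L + s + K)
      ≤⟨ ℚ.+-mono-≤ sum≤ (nestedLimit≤recip (1≤w , tp) 1≤w 1≤K (ℕ.m≤n+m K (L + s))) ⟩
    sumFrom L K (λ n → partial n M) ℚ.+ sumFrom L K (λ _ → recip (K * K)) ℚ.+ recip K
      ≡⟨ cong (λ z → sumFrom L K (λ n → partial n M) ℚ.+ z ℚ.+ recip K) inner-errors ⟩
    sumFrom L K (λ n → partial n M) ℚ.+ recip K ℚ.+ recip K
      ≤⟨ ℚ.+-monoˡ-≤ (recip K) (ℚ.+-monoˡ-≤ (recip K) (partialSum-prefix a as s L K+L≤M)) ⟩
    partialSum (a ∷ as) s L M ℚ.+ recip K ℚ.+ recip K
      ≡⟨ ℚ.+-assoc (partialSum (a ∷ as) s L M) (recip K) (recip K) ⟩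
    partialSum (a ∷ as) s L M ℚ.+ (recip K ℚ.+ recip K)
      ≡⟨ cong (partialSum (a ∷ as) s L M ℚ.+_) (recip[n+n]+recip[n+n]≡recip 1≤e) ⟩
    partialSum (a ∷ as) s L M ℚ.+ recip e
      ∎
    where
    inner-errors : sumFrom L K (λ _ → recip (K * K)) ≡ recip K
    inner-errors = trans (sumFrom-const L K _) (sym (recip≡fromℕ*recip[*] K 1≤K))

1≤weight : ∀ m (α : Vec ℕ (suc m)) → 1 ≤ last α → 1 ≤ weight (toList α)
1≤weight zero    (x ∷ [])     1≤x = ℕ.≤-trans 1≤x (ℕ.m≤m+n x 0)
1≤weight (suc m) (x ∷ y ∷ ys) 1≤last = ℕ.≤-trans (1≤weight m (y ∷ ys) 1≤last) (ℕ.m≤n+m _ x)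

tailsPositive : ∀ m (α : Vec ℕ (suc m)) → 1 ≤ last α → TailsPositive (toList α)
tailsPositive zero    (x ∷ [])     1≤last = 1≤weight zero (x ∷ []) 1≤last , _
tailsPositive (suc m) (x ∷ y ∷ ys) 1≤last =
  1≤weight (suc m) (x ∷ y ∷ ys) 1≤last , tailsPositive m (y ∷ ys) 1≤last

rhoPartial≡partialSum : ∀ as M → rhoPartial as M ≡ partialSum as 0 1 M
rhoPartial≡partialSum as M = trans (nestedSum≡recip*partialSum as 0 1 M 1) (ℚ.*-identityˡ _)

recip[weight!*prodTails]≡nestedLimit : ∀ as → recip (weight as ! * prodTails as) ≡ nestedLimit as 1
recip[weight!*prodTails]≡nestedLimit as = begin
  recip (weight as ! * prodTails as)               ≡⟨ cong recip (ℕ.*-comm (weight as !) (prodTails as)) ⟩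
  recip (prodTails as * weight as !)               ≡⟨ recip-* (prodTails as) (weight as !) ⟩
  recip (prodTails as) ℚ.* recip (weight as !)     ≡⟨ cong (λ n → recip (prodTails as) ℚ.* recip n) rising1≡! ⟨
  nestedLimit as 1                                 ∎
  where
  open ≡-Reasoning
  rising1≡! : rising 1 (weight as) ≡ weight as !
  rising1≡! = trans (sym (ℕ.*-identityʳ _)) (rising-! 0 (weight as))

proposition2p1 : (m : ℕ) (α : Vec ℕ (suc m)) → 1 ≤ last α →
    ConvergesTo (rhoPartial (toList α)) (recip (weight (toList α) ! * prodTails (toList α)))
proposition2p1 m α 1≤last ε 0<ε with recip-archimedean ε 0<ε
... | j , recip<ε = eventually-map close
  (nestedLimit≤partialSum+recip αs tp 0 1 (s≤s z≤n) (s≤s (z≤n {j})))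
  where
  αs : List ℕ
  αs = toList α
  tp : TailsPositive αs
  tp = tailsPositive m α 1≤last
  close : ∀ M → nestedLimit αs 1 ℚ.≤ partialSum αs 0 1 M ℚ.+ recip (suc j) →
          ℚ.∣ rhoPartial αs M ℚ.- recip (weight αs ! * prodTails αs) ∣ ℚ.< ε
  close M limit≤ = subst₂ (λ p q → ℚ.∣ p ℚ.- q ∣ ℚ.< ε)
    (sym (rhoPartial≡partialSum αs M)) (sym (recip[weight!*prodTails]≡nestedLimit αs))
    (∣p-q∣< (partialSum≤nestedLimit αs tp 0 1 M (s≤s z≤n)) limit≤ recip<ε)
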